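{- There exist infinitely many $5$-regular graphs $G$ with a hamiltonian cycle $\mathfrak{h}$ such that $G$ contains no $\mathfrak{h}$-independent dominating set.
   Context: For a graph $G$ with a hamiltonian cycle $\mathfrak{h}$, an $\mathfrak{h}$-independent dominating set of $G$ is a vertex set $S \subseteq V(G)$ that is an independent set in the graph $(V(G), E(\mathfrak{h}))$ and a dominating set in the graph $(V(G), E(G)\setminus E(\mathfrak{h}))$. -}

module Defs where

open import Data.Nat using (ℕ; zero; suc; _≤_)
open import Data.Nat.DivMod using (_%_; m%n<n)
open import Data.Bool using (Bool; true; false)
open import Data.Fin using (Fin; toℕ; fromℕ<)
open import Data.Fin.Subset using (Subset; _∈_; _∉_; ∣_∣)
open import Data.Fin.Permutation using (Permutation′; _⟨$⟩ʳ_)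
open import Data.Vec using (tabulate)
open import Data.Product using (Σ; ∃; _×_; _,_)
open import Data.Sum using (_⊎_)
open import Relation.Binary.PropositionalEquality using (_≡_)
open import Relation.Nullary using (¬_)

record SimpleGraph (n : ℕ) : Set where
  field
    adj     : Fin n → Fin n → Bool
    adj-sym : ∀ u v → adj u v ≡ adj v u
    irrefl  : ∀ v → adj v v ≡ false
open SimpleGraph public

neighbours : ∀ {n} → SimpleGraph n → Fin n → Subset n
neighbours G v = tabulate (adj G v)

degree : ∀ {n} → SimpleGraph n → Fin n → ℕ
degree G v = ∣ neighbours G v ∣

Regular : ∀ {n} → ℕ → SimpleGraph n → Set
Regular k G = ∀ v → degree G v ≡ k

next : ∀ {n} → Fin n → Fin n
next {suc k} i = fromℕ< (m%n<n (suc (toℕ i)) (suc k))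

-- A hamiltonian cycle, given as a cyclic ordering σ(0), σ(1), …, σ(n-1)
-- of all vertices (a permutation of Fin n) with n ≥ 3.
HamCycle : ℕ → Set
HamCycle n = Permutation′ n

hEdge : ∀ {n} → HamCycle n → Fin n → Fin n → Set
hEdge h u v = ∃ λ i → ((h ⟨$⟩ʳ i) ≡ u × (h ⟨$⟩ʳ next i) ≡ v)
                    ⊎ ((h ⟨$⟩ʳ i) ≡ v × (h ⟨$⟩ʳ next i) ≡ u)

IsHamiltonianCycle : ∀ {n} → SimpleGraph n → HamCycle n → Set
IsHamiltonianCycle {n} G h =
  (3 ≤ n) × (∀ i → adj G (h ⟨$⟩ʳ i) (h ⟨$⟩ʳ next i) ≡ true)

IndependentDominating : ∀ {n} → SimpleGraph n → HamCycle n → Subset n → Set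
IndependentDominating G h S =
  (∀ u v → u ∈ S → v ∈ S → ¬ hEdge h u v)
  × (∀ v → v ∉ S → ∃ λ u → u ∈ S × adj G u v ≡ true × ¬ hEdge h u v)

-- The graph is the cycle 0, 1, …, N − 1 cut into blocks of 12 consecutive vertices, with a
-- fixed cubic graph on the 12 positions (the gadget) added as chords inside every block. Each
-- vertex has two cycle neighbours and three chord neighbours, all distinct because their
-- positions in the block are. An h-independent dominating set must dominate every vertex
-- outside it along a chord, hence from within the same block, and it contains no two
-- consecutive vertices of a block; so its trace on one block is an independent set of the
-- path 0 – 1 – ⋯ – 11 dominating the gadget, and a search through all 2¹² subsets finds none.

module Submission where

open import Defs
open import Data.Bool using (Bool; true; false; _∧_; _∨_)
open import Data.Bool.Properties using (∨-comm; ∨-assoc)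
open import Data.Nat using (ℕ; zero; suc; _+_; _*_; _≤_; s≤s; z≤n; NonZero)
open import Data.Nat.DivMod using (_%_; m%n<n; %-distribˡ-+; m%n%n≡m%n; [m+n]%n≡m%n; m<n⇒m%n≡m;
  %-remove-+ˡ; m∣n⇒o%n%m≡o%m)
open import Data.Nat.Divisibility using (divides)
open import Data.Nat.Properties using (+-suc; +-comm; *-comm; ≤-trans; n≤1+n; m≤m*n; m≤m+n)
  renaming (_≟_ to _≟ℕ_)
open import Data.Fin using (Fin; #_; toℕ; fromℕ<; inject₁; combine; quotient; remainder)
  renaming (zero to fzero; suc to fsuc)
open import Data.Fin.Properties using (_≟_; toℕ-fromℕ<; toℕ-injective; toℕ<n; toℕ-combine;
  toℕ-inject₁; remQuot-combine; combine-remQuot; all?)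
open import Data.Fin.Permutation using (id)
open import Data.Fin.Subset using (Subset; _∈_; _∉_; ∣_∣)
open import Data.Fin.Subset.Properties using (_∈?_; anySubset?)
open import Data.List using (List; []; _∷_; length; map)
open import Data.List.Properties using (length-map; map-∘; map-cong; map-id)
open import Data.List.Relation.Unary.Any using (Any; any?; there)
open import Data.List.Relation.Unary.Unique.Propositional using (Unique; _∷_)
import Data.List.Relation.Unary.Unique.DecPropositional as UniqueDec
open import Data.List.Relation.Unary.Unique.Propositional.Properties using (Unique[x∷xs]⇒x∉xs; map⁻)
open import Data.List.Membership.Propositional using (lose) renaming (_∈_ to _∈ₗ_)
open import Data.List.Membership.Propositional.Properties using (∈-map⁺; ∈-map⁻)
open import Data.List.Relation.Unary.All using (_∷_)
open import Data.Vec using ([]; _∷_; tabulate; lookup)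
open import Data.Vec.Properties using (tabulate-cong; lookup∘tabulate; []=⇒lookup; lookup⇒[]=)
open import Data.Product using (Σ; ∃; _×_; _,_; proj₁; proj₂)
open import Data.Sum using (inj₁; inj₂)
open import Data.Empty using (⊥-elim)
open import Function using (_∘_; _⇔_; mk⇔; Equivalence)
open import Relation.Nullary using (Dec; does; yes; no; ¬_; ¬?; _×-dec_; _→-dec_)
open import Relation.Nullary.Decidable using (dec-true; dec-false; from-yes; from-no)
open import Relation.Unary using (Decidable)
open import Relation.Binary.PropositionalEquality

private variable n : ℕ

does-cong : ∀ {p q} {P : Set p} {Q : Set q} → P ⇔ Q → (P? : Dec P) (Q? : Dec Q) → does P? ≡ does Q?
does-cong P⇔Q (yes _) (yes _) = refl
does-cong P⇔Q (yes p) (no ¬q) = ⊥-elim (¬q (Equivalence.to P⇔Q p))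
does-cong P⇔Q (no ¬p) (yes q) = ⊥-elim (¬p (Equivalence.from P⇔Q q))
does-cong P⇔Q (no _) (no _) = refl

witness : ∀ {p} {P : Set p} (P? : Dec P) → does P? ≡ true → P
witness (yes p) _ = p
witness (no _) ()

∨-introˡ : ∀ {x y} → x ≡ true → x ∨ y ≡ true
∨-introˡ refl = refl

∨-false-elim : ∀ {x y} → x ∨ y ≡ true → x ≡ false → y ≡ true
∨-false-elim x∨y refl = x∨y

_∈ₗ?_ : (v : Fin n) (L : List (Fin n)) → Dec (v ∈ₗ L)
v ∈ₗ? L = any? (v ≟_) L

∣tabulate-false∣ : ∣ tabulate {n = n} (λ _ → false) ∣ ≡ 0
∣tabulate-false∣ {zero} = refl
∣tabulate-false∣ {suc n} = ∣tabulate-false∣ {n}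

∣tabulate-∨∣ : (f g : Fin n → Bool) → (∀ v → f v ∧ g v ≡ false) →
               ∣ tabulate (λ v → f v ∨ g v) ∣ ≡ ∣ tabulate f ∣ + ∣ tabulate g ∣
∣tabulate-∨∣ {zero} f g disjoint = refl
∣tabulate-∨∣ {suc n} f g disjoint
  with f fzero | g fzero | disjoint fzero | ∣tabulate-∨∣ (f ∘ fsuc) (g ∘ fsuc) (disjoint ∘ fsuc)
... | true  | true  | () | _
... | true  | false | _ | ih = cong suc ih
... | false | true  | _ | ih = trans (cong suc ih) (sym (+-suc _ _))
... | false | false | _ | ih = ih

∣tabulate-≟∣ : (x : Fin n) → ∣ tabulate (λ v → does (v ≟ x)) ∣ ≡ 1
∣tabulate-≟∣ {suc n} fzero = cong suc (∣tabulate-false∣ {n})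
∣tabulate-≟∣ {suc n} (fsuc x) = ∣tabulate-≟∣ x

∣tabulate-∈ₗ∣ : (L : List (Fin n)) → Unique L → ∣ tabulate (λ v → does (v ∈ₗ? L)) ∣ ≡ length L
∣tabulate-∈ₗ∣ {n} [] _ = ∣tabulate-false∣ {n}
∣tabulate-∈ₗ∣ (x ∷ L) x∷L!@(_ ∷ L!) =
  trans (∣tabulate-∨∣ (λ v → does (v ≟ x)) (λ v → does (v ∈ₗ? L)) disjoint)
        (cong₂ _+_ (∣tabulate-≟∣ x) (∣tabulate-∈ₗ∣ L L!))
  where
  disjoint : ∀ v → does (v ≟ x) ∧ does (v ∈ₗ? L) ≡ false
  disjoint v with v ≟ x
  ... | yes refl = dec-false (x ∈ₗ? L) (Unique[x∷xs]⇒x∉xs x∷L!)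
  ... | no _ = refl

degree≡length : (G : SimpleGraph n) (u : Fin n) (L : List (Fin n)) → Unique L →
                (∀ v → adj G u v ≡ does (v ∈ₗ? L)) → degree G u ≡ length L
degree≡length G u L L! adj≡∈ = trans (cong ∣_∣ (tabulate-cong adj≡∈)) (∣tabulate-∈ₗ∣ L L!)

toℕ-next : (i : Fin (suc n)) → toℕ (next i) ≡ suc (toℕ i) % suc n
toℕ-next i = toℕ-fromℕ< _

prev : Fin (suc n) → Fin (suc n)
prev {n} i = fromℕ< (m%n<n (toℕ i + n) (suc n))

[m%d+n]%d≡[m+n]%d : ∀ m n d .{{_ : NonZero d}} → (m % d + n) % d ≡ (m + n) % d
[m%d+n]%d≡[m+n]%d m n d = begin
  (m % d + n) % d          ≡⟨ %-distribˡ-+ (m % d) n d ⟩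
  (m % d % d + n % d) % d  ≡⟨ cong (λ x → (x + n % d) % d) (m%n%n≡m%n m d) ⟩
  (m % d + n % d) % d      ≡⟨ %-distribˡ-+ m n d ⟨
  (m + n) % d              ∎
  where open ≡-Reasoning

[m+n%d]%d≡[m+n]%d : ∀ m n d .{{_ : NonZero d}} → (m + n % d) % d ≡ (m + n) % d
[m+n%d]%d≡[m+n]%d m n d = begin
  (m + n % d) % d  ≡⟨ cong (_% d) (+-comm m (n % d)) ⟩
  (n % d + m) % d  ≡⟨ [m%d+n]%d≡[m+n]%d n m d ⟩
  (n + m) % d      ≡⟨ cong (_% d) (+-comm n m) ⟩
  (m + n) % d      ∎
  where open ≡-Reasoning

next-prev : (i : Fin (suc n)) → next (prev i) ≡ i
next-prev {n} i = toℕ-injective (begin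
  toℕ (next (prev i))                ≡⟨ toℕ-next (prev i) ⟩
  suc (toℕ (prev i)) % suc n         ≡⟨ cong (λ x → suc x % suc n) (toℕ-fromℕ< _) ⟩
  (1 + (toℕ i + n) % suc n) % suc n  ≡⟨ [m+n%d]%d≡[m+n]%d 1 (toℕ i + n) (suc n) ⟩
  suc (toℕ i + n) % suc n            ≡⟨ cong (_% suc n) (+-suc (toℕ i) n) ⟨
  (toℕ i + suc n) % suc n            ≡⟨ [m+n]%n≡m%n (toℕ i) (suc n) ⟩
  toℕ i % suc n                      ≡⟨ m<n⇒m%n≡m (toℕ<n i) ⟩
  toℕ i                              ∎)
  where open ≡-Reasoning

prev-next : (i : Fin (suc n)) → prev (next i) ≡ i
prev-next {n} i = toℕ-injective (begin
  toℕ (prev (next i))                   ≡⟨ toℕ-fromℕ< _ ⟩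
  (toℕ (next i) + n) % suc n            ≡⟨ cong (λ x → (x + n) % suc n) (toℕ-next i) ⟩
  (suc (toℕ i) % suc n + n) % suc n     ≡⟨ [m%d+n]%d≡[m+n]%d (suc (toℕ i)) n (suc n) ⟩
  (suc (toℕ i) + n) % suc n             ≡⟨ cong (_% suc n) (+-suc (toℕ i) n) ⟨
  (toℕ i + suc n) % suc n               ≡⟨ [m+n]%n≡m%n (toℕ i) (suc n) ⟩
  toℕ i % suc n                         ≡⟨ m<n⇒m%n≡m (toℕ<n i) ⟩
  toℕ i                                 ∎)
  where open ≡-Reasoning

≡next⇔prev≡ : {i j : Fin (suc n)} → i ≡ next j ⇔ j ≡ prev i
≡next⇔prev≡ {i = i} {j} = mk⇔ (λ { refl → sym (prev-next j) }) (λ { refl → sym (next-prev i) })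

next≢prev⇒3≤n : (i : Fin (suc n)) → next i ≢ prev i → 3 ≤ suc n
next≢prev⇒3≤n {zero} fzero ne = ⊥-elim (ne refl)
next≢prev⇒3≤n {suc zero} fzero ne = ⊥-elim (ne refl)
next≢prev⇒3≤n {suc zero} (fsuc fzero) ne = ⊥-elim (ne refl)
next≢prev⇒3≤n {suc (suc n)} _ _ = s≤s (s≤s (s≤s z≤n))

toℕ-remainder : ∀ {m} c (v : Fin (m * suc c)) → toℕ (remainder {m} (suc c) v) ≡ toℕ v % suc c
toℕ-remainder {m} c v = begin
  toℕ r                              ≡⟨ m<n⇒m%n≡m (toℕ<n r) ⟨
  toℕ r % suc c                      ≡⟨ %-remove-+ˡ (toℕ r) (divides (toℕ q) (*-comm (suc c) (toℕ q))) ⟨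
  (suc c * toℕ q + toℕ r) % suc c    ≡⟨ cong (_% suc c) (toℕ-combine q r) ⟨
  toℕ (combine q r) % suc c          ≡⟨ cong (λ w → toℕ w % suc c) (combine-remQuot {m} (suc c) v) ⟩
  toℕ v % suc c                      ∎
  where
  open ≡-Reasoning
  q = quotient {m} (suc c) v
  r = remainder {m} (suc c) v

module _ {k c : ℕ} where
  private
    b N : ℕ
    b = suc c
    N = suc k * suc c
    rem : Fin N → Fin b
    rem = remainder {suc k} b

  remainder-next : (v : Fin N) → rem (next v) ≡ next (rem v)
  remainder-next v = toℕ-injective (begin
    toℕ (rem (next v))         ≡⟨ toℕ-remainder {suc k} c (next v) ⟩
    toℕ (next v) % b           ≡⟨ cong (_% b) (toℕ-next v) ⟩
    suc (toℕ v) % N % b        ≡⟨ m∣n⇒o%n%m≡o%m b N (suc (toℕ v)) (divides (suc k) refl) ⟩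
    suc (toℕ v) % b            ≡⟨ [m+n%d]%d≡[m+n]%d 1 (toℕ v) b ⟨
    suc (toℕ v % b) % b        ≡⟨ cong (λ x → suc x % b) (toℕ-remainder {suc k} c v) ⟨
    suc (toℕ (rem v)) % b      ≡⟨ toℕ-next (rem v) ⟨
    toℕ (next (rem v))         ∎)
    where open ≡-Reasoning

  remainder-prev : (v : Fin N) → rem (prev v) ≡ prev (rem v)
  remainder-prev v = begin
    rem (prev v)                ≡⟨ prev-next _ ⟨
    prev (next (rem (prev v)))  ≡⟨ cong prev (remainder-next (prev v)) ⟨
    prev (rem (next (prev v)))  ≡⟨ cong (prev ∘ rem) (next-prev v) ⟩
    prev (rem v)                ∎
    where open ≡-Reasoning

  next-combine-inject₁ : (q : Fin (suc k)) (i : Fin c) → next (combine q (inject₁ i)) ≡ combine {n = b} q (fsuc i)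
  next-combine-inject₁ q i = toℕ-injective (begin
    toℕ (next (combine q (inject₁ i)))          ≡⟨ toℕ-next _ ⟩
    suc (toℕ (combine q (inject₁ i))) % N       ≡⟨ cong (λ x → suc x % N) (toℕ-combine q (inject₁ i)) ⟩
    suc (b * toℕ q + toℕ (inject₁ i)) % N       ≡⟨ cong (λ x → suc (b * toℕ q + x) % N) (toℕ-inject₁ i) ⟩
    suc (b * toℕ q + toℕ i) % N                 ≡⟨ cong (_% N) (+-suc (b * toℕ q) (toℕ i)) ⟨
    (b * toℕ q + toℕ (fsuc i)) % N              ≡⟨ cong (_% N) (toℕ-combine q (fsuc i)) ⟨
    toℕ (combine q (fsuc i)) % N                ≡⟨ m<n⇒m%n≡m (toℕ<n _) ⟩
    toℕ (combine {n = b} q (fsuc i))            ∎)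
    where open ≡-Reasoning

PathIndependent : ∀ {c} → Subset (suc c) → Set
PathIndependent T = ∀ i → ¬ (inject₁ i ∈ T × fsuc i ∈ T)

pathIndependent? : ∀ {c} → Decidable (PathIndependent {c})
pathIndependent? T = all? (λ i → ¬? ((inject₁ i ∈? T) ×-dec (fsuc i ∈? T)))

module _ {c : ℕ} (chords : Fin (suc c) → List (Fin (suc c))) where

  ChordDominating : Subset (suc c) → Set
  ChordDominating T = ∀ r → r ∉ T → Any (_∈ T) (chords r)

  chordDominating? : Decidable ChordDominating
  chordDominating? T = all? (λ r → ¬? (r ∈? T) →-dec any? (_∈? T) (chords r))

-- Vertex combine q r is position r of the q-th copy of the gadget.
module CycleOfGadgets
  {c : ℕ} (chords : Fin (suc c) → List (Fin (suc c)))
  (chords-sym : ∀ {r s} → s ∈ₗ chords r → r ∈ₗ chords s)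
  (closedNeighbourhood-unique : ∀ r → Unique (r ∷ next r ∷ prev r ∷ chords r))
  (k : ℕ)
  where

  private
    N : ℕ
    N = suc k * suc c

  block : Fin N → Fin (suc k)
  block = quotient (suc c)

  pos : Fin N → Fin (suc c)
  pos = remainder {suc k} (suc c)

  block-combine : (q : Fin (suc k)) (r : Fin (suc c)) → block (combine q r) ≡ q
  block-combine q r = cong proj₁ (remQuot-combine q r)

  pos-combine : (q : Fin (suc k)) (r : Fin (suc c)) → pos (combine q r) ≡ r
  pos-combine q r = cong proj₂ (remQuot-combine q r)

  combine-block-pos : (v : Fin N) → combine (block v) (pos v) ≡ v
  combine-block-pos = combine-remQuot {suc k} (suc c)

  ≢next : ∀ r → r ≢ next r
  ≢next r with closedNeighbourhood-unique r
  ... | (r≢next ∷ _) ∷ _ = r≢next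

  next≢prev : ∀ r → next r ≢ prev r
  next≢prev r with closedNeighbourhood-unique r
  ... | _ ∷ (next≢prev ∷ _) ∷ _ = next≢prev

  ∉chords : ∀ r → ¬ r ∈ₗ chords r
  ∉chords r = Unique[x∷xs]⇒x∉xs (closedNeighbourhood-unique r) ∘ there ∘ there

  neighbours-unique : ∀ r → Unique (next r ∷ prev r ∷ chords r)
  neighbours-unique r with closedNeighbourhood-unique r
  ... | _ ∷ u = u

  ChordEdge : Fin N → Fin N → Set
  ChordEdge u v = block u ≡ block v × pos v ∈ₗ chords (pos u)

  chordEdge? : ∀ u v → Dec (ChordEdge u v)
  chordEdge? u v = (block u ≟ block v) ×-dec (pos v ∈ₗ? chords (pos u))

  chordEdge-sym : ∀ u v → ChordEdge u v → ChordEdge v u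
  chordEdge-sym u v (same , chord) = sym same , chords-sym chord

  cycleAdj : Fin N → Fin N → Bool
  cycleAdj u v = does (v ≟ next u) ∨ does (u ≟ next v)

  graph : SimpleGraph N
  graph = record
    { adj     = λ u v → cycleAdj u v ∨ does (chordEdge? u v)
    ; adj-sym = λ u v → cong₂ _∨_ (∨-comm (does (v ≟ next u)) _)
                                  (does-cong (mk⇔ (chordEdge-sym u v) (chordEdge-sym v u)) (chordEdge? u v) (chordEdge? v u))
    ; irrefl  = λ v → cong₂ _∨_
        (cong₂ _∨_ (dec-false (v ≟ next v) (≢next-cycle v)) (dec-false (v ≟ next v) (≢next-cycle v)))
        (dec-false (chordEdge? v v) (∉chords (pos v) ∘ proj₂))
    }
    where
    ≢next-cycle : ∀ v → v ≢ next v
    ≢next-cycle v v≡next = ≢next (pos v) (trans (cong pos v≡next) (remainder-next {k} v))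

  hamiltonian : IsHamiltonianCycle graph id
  hamiltonian = ≤-trans (next≢prev⇒3≤n fzero (next≢prev fzero)) (m≤m+n (suc c) (k * suc c))
              , λ i → ∨-introˡ (∨-introˡ (dec-true (next i ≟ next i) refl))

  neighbourList : Fin N → List (Fin N)
  neighbourList u = next u ∷ prev u ∷ map (combine (block u)) (chords (pos u))

  map-pos-neighbourList : ∀ u → map pos (neighbourList u) ≡ next (pos u) ∷ prev (pos u) ∷ chords (pos u)
  map-pos-neighbourList u = cong₂ _∷_ (remainder-next {k} u) (cong₂ _∷_ (remainder-prev {k} u) (begin
    map pos (map (combine (block u)) (chords (pos u)))  ≡⟨ map-∘ (chords (pos u)) ⟨
    map (pos ∘ combine (block u)) (chords (pos u))     ≡⟨ map-cong (pos-combine (block u)) (chords (pos u)) ⟩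
    map (λ r → r) (chords (pos u))                     ≡⟨ map-id (chords (pos u)) ⟩
    chords (pos u)                                     ∎))
    where open ≡-Reasoning

  neighbourList-unique : ∀ u → Unique (neighbourList u)
  neighbourList-unique u = map⁻ (subst Unique (sym (map-pos-neighbourList u)) (neighbours-unique (pos u)))

  chordEdge⇔∈ : ∀ u v → ChordEdge u v ⇔ v ∈ₗ map (combine (block u)) (chords (pos u))
  chordEdge⇔∈ u v = mk⇔ to from
    where
    to : ChordEdge u v → v ∈ₗ map (combine (block u)) (chords (pos u))
    to (same , chord) = subst (_∈ₗ map (combine (block u)) (chords (pos u)))
      (trans (cong (λ q → combine q (pos v)) same) (combine-block-pos v))
      (∈-map⁺ (combine (block u)) chord)
    from : v ∈ₗ map (combine (block u)) (chords (pos u)) → ChordEdge u v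
    from v∈ with ∈-map⁻ (combine (block u)) v∈
    ... | r , chord , refl = sym (block-combine (block u) r) , subst (_∈ₗ chords (pos u)) (sym (pos-combine (block u) r)) chord

  adj≡∈neighbourList : ∀ u v → adj graph u v ≡ does (v ∈ₗ? neighbourList u)
  adj≡∈neighbourList u v = trans (∨-assoc (does (v ≟ next u)) _ _)
    (cong₂ (λ x y → does (v ≟ next u) ∨ (x ∨ y))
      (does-cong ≡next⇔prev≡ (u ≟ next v) (v ≟ prev u))
      (does-cong (chordEdge⇔∈ u v) (chordEdge? u v) (v ∈ₗ? map (combine (block u)) (chords (pos u)))))

  regular : ∀ {d} → (∀ r → length (chords r) ≡ d) → Regular (2 + d) graph
  regular {d} chords-length u = begin
    degree graph u                      ≡⟨ degree≡length graph u (neighbourList u) (neighbourList-unique u) (adj≡∈neighbourList u) ⟩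
    length (neighbourList u)            ≡⟨ cong (2 +_) (length-map (combine (block u)) (chords (pos u))) ⟩
    2 + length (chords (pos u))         ≡⟨ cong (2 +_) (chords-length (pos u)) ⟩
    2 + d                               ∎
    where open ≡-Reasoning

  restrict : Fin (suc k) → Subset N → Subset (suc c)
  restrict q S = tabulate (λ r → lookup S (combine q r))

  ∈-restrict⇔ : ∀ q S {r} → r ∈ restrict q S ⇔ combine q r ∈ S
  ∈-restrict⇔ q S {r} = mk⇔
    (λ r∈ → lookup⇒[]= (combine q r) S (trans (sym (lookup∘tabulate restricted r)) ([]=⇒lookup r∈)))
    (λ qr∈ → lookup⇒[]= r (restrict q S) (trans (lookup∘tabulate restricted r) ([]=⇒lookup qr∈)))
    where
    restricted : Fin (suc c) → Bool
    restricted r = lookup S (combine q r)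

  chordEdge-off-cycle : ∀ {u v} → adj graph u v ≡ true → ¬ hEdge id u v → ChordEdge u v
  chordEdge-off-cycle {u} {v} u~v not-cycle = witness (chordEdge? u v) (∨-false-elim u~v (cong₂ _∨_
    (dec-false (v ≟ next u) (λ v≡ → not-cycle (u , inj₁ (refl , sym v≡))))
    (dec-false (u ≟ next v) (λ u≡ → not-cycle (v , inj₂ (refl , sym u≡))))))

  module _ {S : Subset N} (q : Fin (suc k)) where

    restrict-pathIndependent : (∀ u v → u ∈ S → v ∈ S → ¬ hEdge id u v) → PathIndependent (restrict q S)
    restrict-pathIndependent independent i (i∈ , si∈) =
      independent _ _ (Equivalence.to (∈-restrict⇔ q S) i∈) (Equivalence.to (∈-restrict⇔ q S) si∈)
        (combine q (inject₁ i) , inj₁ (refl , next-combine-inject₁ q i))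

    restrict-chordDominating : (∀ v → v ∉ S → ∃ λ u → u ∈ S × adj graph u v ≡ true × ¬ hEdge id u v) →
                               ChordDominating chords (restrict q S)
    restrict-chordDominating dominating r r∉ with dominating (combine q r) (r∉ ∘ Equivalence.from (∈-restrict⇔ q S))
    ... | u , u∈S , u~v , not-cycle with chordEdge-off-cycle u~v not-cycle
    ...   | same , chord =
      lose (chords-sym (subst (_∈ₗ chords (pos u)) (pos-combine q r) chord))
           (Equivalence.from (∈-restrict⇔ q S) (subst (_∈ S) (sym u≡) u∈S))
      where
      u≡ : combine q (pos u) ≡ u
      u≡ = trans (cong (λ x → combine x (pos u)) (sym (trans same (block-combine q r)))) (combine-block-pos u)

  noIndependentDominating : ¬ ∃ (λ T → PathIndependent T × ChordDominating chords T) →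
                            ¬ ∃ λ S → IndependentDominating graph id S
  noIndependentDominating none (S , independent , dominating) =
    none (restrict fzero S , restrict-pathIndependent fzero independent , restrict-chordDominating fzero dominating)

gadgetChords : Fin 12 → List (Fin 12)
gadgetChords = lookup
  ( (# 2 ∷ # 3 ∷ # 10 ∷ [])
  ∷ (# 5 ∷ # 7 ∷ # 8 ∷ [])
  ∷ (# 0 ∷ # 4 ∷ # 5 ∷ [])
  ∷ (# 0 ∷ # 8 ∷ # 11 ∷ [])
  ∷ (# 2 ∷ # 6 ∷ # 9 ∷ [])
  ∷ (# 1 ∷ # 2 ∷ # 11 ∷ [])
  ∷ (# 4 ∷ # 8 ∷ # 10 ∷ [])
  ∷ (# 1 ∷ # 9 ∷ # 10 ∷ [])
  ∷ (# 1 ∷ # 3 ∷ # 6 ∷ [])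
  ∷ (# 4 ∷ # 7 ∷ # 11 ∷ [])
  ∷ (# 0 ∷ # 6 ∷ # 7 ∷ [])
  ∷ (# 3 ∷ # 5 ∷ # 9 ∷ [])
  ∷ [])

gadget-sym : ∀ {r s} → s ∈ₗ gadgetChords r → r ∈ₗ gadgetChords s
gadget-sym {r} {s} = from-yes (all? λ r → all? λ s → (s ∈ₗ? gadgetChords r) →-dec (r ∈ₗ? gadgetChords s)) r s

gadget-unique : ∀ r → Unique (r ∷ next r ∷ prev r ∷ gadgetChords r)
gadget-unique = from-yes (all? λ r → UniqueDec.unique? _≟_ (r ∷ next r ∷ prev r ∷ gadgetChords r))

gadget-cubic : ∀ r → length (gadgetChords r) ≡ 3
gadget-cubic = from-yes (all? λ r → length (gadgetChords r) ≟ℕ 3)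

gadget-noIndependentDominating : ¬ ∃ λ T → PathIndependent T × ChordDominating gadgetChords T
gadget-noIndependentDominating =
  from-no (anySubset? λ T → pathIndependent? T ×-dec chordDominating? gadgetChords T)

proposition1 : ∀ (m : ℕ) → Σ ℕ λ n → m ≤ n × Σ (SimpleGraph n) λ G → Regular 5 G
                 × Σ (HamCycle n) λ h → IsHamiltonianCycle G h
                 × ¬ (Σ (Subset n) λ S → IndependentDominating G h S)
proposition1 m = suc m * 12 , ≤-trans (n≤1+n m) (m≤m*n (suc m) 12)
               , graph , regular gadget-cubic
               , id , hamiltonian , noIndependentDominating gadget-noIndependentDominating
  where open CycleOfGadgets gadgetChords gadget-sym gadget-unique m
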